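{- Let $S$ be a $(v,k,\mu)$ sum set in a finite group $G$ of order $v$, and let $n = k^2 - \mu v$. If $G$ has a normal subgroup of index $2$, then $n$ is the square of an integer. In particular, if $k$ is odd, then $n$ is a nonzero square.
   Context: For $a \in G$, the number of ways to write $a$ as a product in $S$ is the number of ordered pairs $(x,y) \in S\times S$ with $xy = a$. $S$ with $|S|=k$ is a $(v,k,\mu)$ sum set if every nonidentity element of $G$ can be written as a product in $S$ in exactly $\mu$ ways. -}

module Defs where

open import Data.Nat using (ℕ; _*_)
open import Data.Fin using (Fin)
open import Data.Fin.Properties using (_≟_)
open import Data.Fin.Subset using (Subset; _∈_; ∣_∣)
open import Data.Fin.Subset.Properties using (_∈?_)
open import Data.List using (List; length; filter; cartesianProduct; allFin)
open import Data.Product using (_×_; _,_; proj₁; proj₂)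
open import Relation.Nullary using (¬_)
open import Relation.Nullary.Decidable using (_×-dec_)
open import Relation.Binary.PropositionalEquality using (_≡_)
open import Algebra.Structures using (IsGroup)

-- A finite group of order v, presented on the carrier Fin v
-- (every finite group of order v is isomorphic to one of these).
record FinGroup (v : ℕ) : Set where
  field
    _∙_     : Fin v → Fin v → Fin v
    ε       : Fin v
    _⁻¹     : Fin v → Fin v
    isGroup : IsGroup _≡_ _∙_ ε _⁻¹

module _ {v : ℕ} (G : FinGroup v) where
  open FinGroup G

  ways : Subset v → Fin v → ℕ
  ways S a = length (filter (λ p → (proj₁ p ∈? S) ×-dec ((proj₂ p ∈? S) ×-dec ((proj₁ p ∙ proj₂ p) ≟ a)))
                            (cartesianProduct (allFin v) (allFin v)))

  IsSumSet : Subset v → ℕ → ℕ → Set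
  IsSumSet S k μ = (∣ S ∣ ≡ k) × (∀ a → ¬ (a ≡ ε) → ways S a ≡ μ)

  IsSubgroup : Subset v → Set
  IsSubgroup H = (ε ∈ H) × (∀ x y → x ∈ H → y ∈ H → (x ∙ y) ∈ H) × (∀ x → x ∈ H → (x ⁻¹) ∈ H)

  IsNormal : Subset v → Set
  IsNormal H = ∀ g h → h ∈ H → ((g ∙ h) ∙ (g ⁻¹)) ∈ H

  HasNormalSubgroupOfIndex2 : Set
  HasNormalSubgroupOfIndex2 =
    Data.Product.Σ (Subset v) (λ H → IsSubgroup H × IsNormal H × (2 * ∣ H ∣ ≡ v))

-- Let χ = 2·𝟙_H − 1 be the ±1 character of G with kernel H and T = Σ_{x ∈ S} χ x.
-- For any character f, expanding (Σ_{x ∈ S} f x)² as Σ_a f a · ways a and using that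
-- ways is μ away from the identity gives μ · Σ f + (ways ε − μ). The trivial character
-- gives k² = μ v + (ways ε − μ), and χ, whose values sum to 0, gives T² = ways ε − μ;
-- hence k² − μ v = T². Moreover k + T = 2 |S ∩ H|, so T ≠ 0 when k is odd.
module Submission where

open import Defs
open import Data.Nat using (ℕ; _%_)
open import Data.Fin.Subset using (Subset)
open import Data.Integer using (ℤ; +_; _-_; _*_)
open import Data.Product using (_×_; ∃)
open import Relation.Nullary using (¬_)
open import Relation.Binary.PropositionalEquality using (_≡_)

open import Level using (0ℓ)
open import Function using (_∘_; id)
open import Data.Bool using (true; false; if_then_else_)
open import Data.Nat as ℕ using (zero; suc)
import Data.Nat.Properties as ℕP
open import Data.Nat.DivMod using (m*n%n≡0)
open import Data.Integer using (0ℤ; 1ℤ; -1ℤ; _+_; _≤_; +≤+; -[1+_])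
import Data.Integer.Properties as ℤP
open import Data.Integer.Tactic.RingSolver using (solve-∀)
open import Data.Fin using (Fin; zero; suc)
open import Data.Fin.Properties using (_≟_)
open import Data.Fin.Subset using (_∈_; _∉_; ∣_∣; inside; outside)
open import Data.Vec using (_∷_; [])
open import Data.Fin.Subset.Properties using (_∈?_)
open import Data.Fin.Permutation using (Permutation′; permutation)
open import Data.List using ([]; _∷_; length; filter; map; _++_; tabulate; cartesianProduct; allFin)
import Data.List.Properties as ListP
open import Data.Product using (_,_; proj₁; proj₂)
open import Data.Sum using ([_,_]′)
open import Data.Empty using (⊥-elim)
open import Relation.Nullary using (Dec; yes; no; does)
open import Relation.Nullary.Decidable using (_×-dec_)
open import Relation.Unary using (Pred; Decidable)
open import Relation.Binary.PropositionalEquality using (refl; sym; trans; cong; cong₂; subst; _≢_; module ≡-Reasoning)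
open import Algebra.Bundles using (Group)
open import Algebra.Properties.Semiring.Sum ℤP.+-*-semiring

-- Defined through does, so that 𝟙 (suc i ≟ suc j) and 𝟙 (suc i ∈? b ∷ p) compute to
-- 𝟙 (i ≟ j) and 𝟙 (i ∈? p).
𝟙 : ∀ {p} {P : Set p} → Dec P → ℤ
𝟙 d = if does d then 1ℤ else 0ℤ

𝟙-×-dec : ∀ {p q} {P : Set p} {Q : Set q} (a : Dec P) (b : Dec Q) → 𝟙 (a ×-dec b) ≡ 𝟙 a * 𝟙 b
𝟙-×-dec (yes _) (yes _) = refl
𝟙-×-dec (yes _) (no _)  = refl
𝟙-×-dec (no _)  (yes _) = refl
𝟙-×-dec (no _)  (no _)  = refl

∑-const : ∀ n c → ∑[ i < n ] c ≡ + n * c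
∑-const zero    c = sym (ℤP.*-zeroˡ c)
∑-const (suc n) c = trans (cong (_+_ c) (∑-const n c)) (sym (ℤP.suc-* (+ n) c))

∑-*-𝟙≟ : ∀ {n} (f : Fin n → ℤ) (c : Fin n) → ∑[ a < n ] (f a * 𝟙 (c ≟ a)) ≡ f c
∑-*-𝟙≟ {suc n} f zero = begin
    f zero * 1ℤ + ∑[ a < n ] (f (suc a) * 0ℤ)
  ≡⟨ cong₂ _+_ (ℤP.*-identityʳ (f zero)) (trans (sum-cong-≗ (ℤP.*-zeroʳ ∘ f ∘ suc)) (sum-replicate-zero n)) ⟩
    f zero + 0ℤ
  ≡⟨ ℤP.+-identityʳ (f zero) ⟩
    f zero
  ∎
  where open ≡-Reasoning
∑-*-𝟙≟ {suc n} f (suc c) =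
  trans (cong₂ _+_ (ℤP.*-zeroʳ (f zero)) refl) (trans (ℤP.+-identityˡ _) (∑-*-𝟙≟ (f ∘ suc) c))

𝟙[_] : ∀ {n} → Subset n → Fin n → ℤ
𝟙[ p ] x = 𝟙 (x ∈? p)

∣p∣≡∑𝟙[p] : ∀ {n} (p : Subset n) → + ∣ p ∣ ≡ ∑[ x < n ] 𝟙[ p ] x
∣p∣≡∑𝟙[p] []            = refl
∣p∣≡∑𝟙[p] (inside ∷ p)  = cong (_+_ 1ℤ) (∣p∣≡∑𝟙[p] p)
∣p∣≡∑𝟙[p] (outside ∷ p) = trans (∣p∣≡∑𝟙[p] p) (sym (ℤP.+-identityˡ _))

module _ {a p} {A : Set a} {P : Pred A p} (P? : Decidable P) where

  length-filter-map : ∀ {b} {B : Set b} (f : B → A) xs → length (filter P? (map f xs)) ≡ length (filter (P? ∘ f) xs)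
  length-filter-map f []       = refl
  length-filter-map f (x ∷ xs) with does (P? (f x))
  ... | true  = cong suc (length-filter-map f xs)
  ... | false = length-filter-map f xs

  length-filter-tabulate : ∀ {n} (f : Fin n → A) → + length (filter P? (tabulate f)) ≡ ∑[ i < n ] 𝟙 (P? (f i))
  length-filter-tabulate {zero}  f = refl
  length-filter-tabulate {suc n} f with does (P? (f zero))
  ... | true  = cong (_+_ 1ℤ) (length-filter-tabulate (f ∘ suc))
  ... | false = trans (length-filter-tabulate (f ∘ suc)) (sym (ℤP.+-identityˡ _))

length-filter-allFin² : ∀ {p} {m n} {P : Pred (Fin m × Fin n) p} (P? : Decidable P) →
  + length (filter P? (cartesianProduct (allFin m) (allFin n))) ≡ ∑[ i < m ] ∑[ j < n ] 𝟙 (P? (i , j))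
length-filter-allFin² {m = m} {n} P? = go id
  where
    go : ∀ {l} (f : Fin l → Fin m) →
         + length (filter P? (cartesianProduct (tabulate f) (allFin n))) ≡ ∑[ i < l ] ∑[ j < n ] 𝟙 (P? (f i , j))
    go {zero}  f = refl
    go {suc l} f = begin
        + length (filter P? (map (f zero ,_) (allFin n) ++ rest))
      ≡⟨ cong (+_ ∘ length) (ListP.filter-++ P? (map (f zero ,_) (allFin n)) rest) ⟩
        + length (filter P? (map (f zero ,_) (allFin n)) ++ filter P? rest)
      ≡⟨ cong +_ (ListP.length-++ (filter P? (map (f zero ,_) (allFin n)))) ⟩
        + length (filter P? (map (f zero ,_) (allFin n))) + + length (filter P? rest)
      ≡⟨ cong₂ _+_ (trans (cong +_ (length-filter-map P? (f zero ,_) (allFin n))) (length-filter-tabulate (λ j → P? (f zero , j)) id))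
                    (go (f ∘ suc)) ⟩
        ∑[ j < n ] 𝟙 (P? (f zero , j)) + ∑[ i < l ] ∑[ j < n ] 𝟙 (P? (f (suc i) , j))
      ∎
      where open ≡-Reasoning
            rest = cartesianProduct (tabulate (f ∘ suc)) (allFin n)

∑-*-∑ : ∀ {m n} (f : Fin m → ℤ) (g : Fin n → ℤ) → sum f * sum g ≡ ∑[ i < m ] ∑[ j < n ] (f i * g j)
∑-*-∑ f g = trans (*-distribʳ-sum (sum g) f) (sum-cong-≗ (λ i → *-distribˡ-sum (f i) g))

∑-mono-≤ : ∀ {n} {f g : Fin n → ℤ} → (∀ i → f i ≤ g i) → sum f ≤ sum g
∑-mono-≤ {zero}  f≤g = ℤP.≤-refl
∑-mono-≤ {suc n} f≤g = ℤP.+-mono-≤ (f≤g zero) (∑-mono-≤ (f≤g ∘ suc))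

+-≤-≡⇒≡ˡ : ∀ {a b c d} → a ≤ b → c ≤ d → a + c ≡ b + d → a ≡ b
+-≤-≡⇒≡ˡ {a} {b} a≤b c≤d a+c≡b+d with a ℤP.≟ b
... | yes a≡b = a≡b
... | no  a≢b = ⊥-elim (ℤP.<-irrefl a+c≡b+d (ℤP.+-mono-<-≤ (ℤP.≤∧≢⇒< a≤b a≢b) c≤d))

+-≤-≡⇒≡ʳ : ∀ {a b c d} → a ≤ b → c ≤ d → a + c ≡ b + d → c ≡ d
+-≤-≡⇒≡ʳ {a} {b} {c} {d} a≤b c≤d a+c≡b+d =
  +-≤-≡⇒≡ˡ c≤d a≤b (trans (ℤP.+-comm c a) (trans a+c≡b+d (ℤP.+-comm b d)))

∑-≤-≡⇒≗ : ∀ {n} {f g : Fin n → ℤ} → (∀ i → f i ≤ g i) → sum f ≡ sum g → ∀ i → f i ≡ g i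
∑-≤-≡⇒≗ f≤g ∑f≡∑g zero    = +-≤-≡⇒≡ˡ (f≤g zero) (∑-mono-≤ (f≤g ∘ suc)) ∑f≡∑g
∑-≤-≡⇒≗ f≤g ∑f≡∑g (suc i) = ∑-≤-≡⇒≗ (f≤g ∘ suc) (+-≤-≡⇒≡ʳ (f≤g zero) (∑-mono-≤ (f≤g ∘ suc)) ∑f≡∑g) i

odd⇒≢double : ∀ {k} (c : ℤ) → k % 2 ≡ 1 → + k ≢ c + c
odd⇒≢double (+ n) n+n-odd refl = 0≢1 (trans (sym n+n-even) n+n-odd)
  where
    0≢1 : 0 ≢ 1
    0≢1 ()
    n+n-even : (n ℕ.+ n) % 2 ≡ 0
    n+n-even = trans (cong (_% 2) (sym (trans (ℕP.*-comm n 2) (cong (ℕ._+_ n) (ℕP.+-identityʳ n))))) (m*n%n≡0 n 2)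
odd⇒≢double -[1+ n ] _ ()

module _ {v : ℕ} (G : FinGroup v) where
  open FinGroup G

  asGroup : Group 0ℓ 0ℓ
  asGroup = record { Carrier = Fin v ; _≈_ = _≡_ ; _∙_ = _∙_ ; ε = ε ; _⁻¹ = _⁻¹ ; isGroup = isGroup }

  open import Algebra.Properties.Group asGroup using (\\-leftDividesˡ; \\-leftDividesʳ; //-rightDividesʳ)

  translationˡ : Fin v → Permutation′ v
  translationˡ x = permutation (x ∙_) ((x ⁻¹) ∙_) (\\-leftDividesˡ x) (\\-leftDividesʳ x)

  ∑-translateˡ : ∀ x (f : Fin v → ℤ) → ∑[ z < v ] f (x ∙ z) ≡ sum f
  ∑-translateˡ x f = sym (∑-permute f (translationˡ x))

  module _ (S : Subset v) where

    ways≡∑∑ : ∀ a → + ways G S a ≡ ∑[ x < v ] ∑[ y < v ] (𝟙[ S ] x * 𝟙[ S ] y * 𝟙 (x ∙ y ≟ a))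
    ways≡∑∑ a = trans (length-filter-allFin² (λ p → (proj₁ p ∈? S) ×-dec ((proj₂ p ∈? S) ×-dec (proj₁ p ∙ proj₂ p ≟ a))))
      (sum-cong-≗ λ x → sum-cong-≗ λ y → begin
          𝟙 ((x ∈? S) ×-dec ((y ∈? S) ×-dec (x ∙ y ≟ a)))
        ≡⟨ 𝟙-×-dec (x ∈? S) ((y ∈? S) ×-dec (x ∙ y ≟ a)) ⟩
          𝟙[ S ] x * 𝟙 ((y ∈? S) ×-dec (x ∙ y ≟ a))
        ≡⟨ cong (𝟙[ S ] x *_) (𝟙-×-dec (y ∈? S) (x ∙ y ≟ a)) ⟩
          𝟙[ S ] x * (𝟙[ S ] y * 𝟙 (x ∙ y ≟ a))
        ≡⟨ ℤP.*-assoc (𝟙[ S ] x) (𝟙[ S ] y) (𝟙 (x ∙ y ≟ a)) ⟨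
          𝟙[ S ] x * 𝟙[ S ] y * 𝟙 (x ∙ y ≟ a)
        ∎)
      where open ≡-Reasoning

    ∑-*-ways : ∀ (f : Fin v → ℤ) →
      ∑[ a < v ] (f a * + ways G S a) ≡ ∑[ x < v ] ∑[ y < v ] (𝟙[ S ] x * 𝟙[ S ] y * f (x ∙ y))
    ∑-*-ways f = begin
        ∑[ a < v ] (f a * + ways G S a)
      ≡⟨ sum-cong-≗ (λ a → cong (f a *_) (ways≡∑∑ a)) ⟩
        ∑[ a < v ] (f a * ∑[ x < v ] ∑[ y < v ] (s x * s y * 𝟙 (x ∙ y ≟ a)))
      ≡⟨ sum-cong-≗ (λ a → trans (*-distribˡ-sum (f a) (λ x → ∑[ y < v ] (s x * s y * 𝟙 (x ∙ y ≟ a))))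
                                  (sum-cong-≗ λ x → *-distribˡ-sum (f a) (λ y → s x * s y * 𝟙 (x ∙ y ≟ a)))) ⟩
        ∑[ a < v ] ∑[ x < v ] ∑[ y < v ] (f a * (s x * s y * 𝟙 (x ∙ y ≟ a)))
      ≡⟨ trans (∑-comm (λ a x → ∑[ y < v ] (f a * (s x * s y * 𝟙 (x ∙ y ≟ a)))))
               (sum-cong-≗ λ x → ∑-comm (λ a y → f a * (s x * s y * 𝟙 (x ∙ y ≟ a)))) ⟩
        ∑[ x < v ] ∑[ y < v ] ∑[ a < v ] (f a * (s x * s y * 𝟙 (x ∙ y ≟ a)))
      ≡⟨ sum-cong-≗ (λ x → sum-cong-≗ λ y → trans (sum-cong-≗ λ a → reorder (f a) (s x) (s y) _) (∑-*-𝟙≟ (λ a → s x * s y * f a) (x ∙ y))) ⟩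
        ∑[ x < v ] ∑[ y < v ] (s x * s y * f (x ∙ y))
      ∎
      where
        open ≡-Reasoning
        s = 𝟙[ S ]
        reorder : ∀ a b c d → a * (b * c * d) ≡ b * c * a * d
        reorder = solve-∀

    module _ {k μ : ℕ} (sumSet : IsSumSet G S k μ) where

      excess : ℤ
      excess = + ways G S ε - + μ

      ∑𝟙≡k : sum 𝟙[ S ] ≡ + k
      ∑𝟙≡k = trans (sym (∣p∣≡∑𝟙[p] S)) (cong +_ (proj₁ sumSet))

      ways-sumSet : ∀ a → + ways G S a ≡ + μ + excess * 𝟙 (ε ≟ a)
      ways-sumSet a with ε ≟ a
      ... | yes refl = lemma (+ ways G S ε) (+ μ)
        where lemma : ∀ w m → w ≡ m + (w - m) * 1ℤ
              lemma = solve-∀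
      ... | no ε≢a = trans (cong +_ (proj₂ sumSet a (ε≢a ∘ sym))) (lemma (+ μ) excess)
        where lemma : ∀ m d → m ≡ m + d * 0ℤ
              lemma = solve-∀

      ∑-*-ways-sumSet : ∀ (f : Fin v → ℤ) →
        ∑[ a < v ] (f a * + ways G S a) ≡ + μ * sum f + excess * f ε
      ∑-*-ways-sumSet f = begin
          ∑[ a < v ] (f a * + ways G S a)
        ≡⟨ sum-cong-≗ (λ a → trans (cong (f a *_) (ways-sumSet a)) (expand (f a) (+ μ) excess (𝟙 (ε ≟ a)))) ⟩
          ∑[ a < v ] (+ μ * f a + excess * (f a * 𝟙 (ε ≟ a)))
        ≡⟨ ∑-distrib-+ (λ a → + μ * f a) (λ a → excess * (f a * 𝟙 (ε ≟ a))) ⟩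
          ∑[ a < v ] (+ μ * f a) + ∑[ a < v ] (excess * (f a * 𝟙 (ε ≟ a)))
        ≡⟨ cong₂ _+_ (*-distribˡ-sum (+ μ) f) (*-distribˡ-sum excess (λ a → f a * 𝟙 (ε ≟ a))) ⟨
          + μ * sum f + excess * ∑[ a < v ] (f a * 𝟙 (ε ≟ a))
        ≡⟨ cong (λ t → + μ * sum f + excess * t) (∑-*-𝟙≟ f ε) ⟩
          + μ * sum f + excess * f ε
        ∎
        where
          open ≡-Reasoning
          expand : ∀ x m d e → x * (m + d * e) ≡ m * x + d * (x * e)
          expand = solve-∀

      character-sum-square : ∀ (f : Fin v → ℤ) → (∀ x y → f (x ∙ y) ≡ f x * f y) → f ε ≡ 1ℤ →
        ∑[ x < v ] (𝟙[ S ] x * f x) * ∑[ x < v ] (𝟙[ S ] x * f x) ≡ + μ * sum f + excess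
      character-sum-square f f-∙ f-ε = begin
          ∑[ x < v ] (s x * f x) * ∑[ x < v ] (s x * f x)
        ≡⟨ ∑-*-∑ (λ x → s x * f x) (λ y → s y * f y) ⟩
          ∑[ x < v ] ∑[ y < v ] (s x * f x * (s y * f y))
        ≡⟨ sum-cong-≗ (λ x → sum-cong-≗ λ y → trans (regroup (s x) (f x) (s y) (f y)) (cong (s x * s y *_) (sym (f-∙ x y)))) ⟩
          ∑[ x < v ] ∑[ y < v ] (s x * s y * f (x ∙ y))
        ≡⟨ ∑-*-ways f ⟨
          ∑[ a < v ] (f a * + ways G S a)
        ≡⟨ ∑-*-ways-sumSet f ⟩
          + μ * sum f + excess * f ε
        ≡⟨ cong (λ t → + μ * sum f + excess * t) f-ε ⟩
          + μ * sum f + excess * 1ℤ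
        ≡⟨ cong (_+_ (+ μ * sum f)) (ℤP.*-identityʳ _) ⟩
          + μ * sum f + excess
        ∎
        where
          open ≡-Reasoning
          s = 𝟙[ S ]
          regroup : ∀ a b c d → a * b * (c * d) ≡ a * c * (b * d)
          regroup = solve-∀

      k*k≡μ*v+excess : + k * + k ≡ + μ * + v + excess
      k*k≡μ*v+excess = begin
          + k * + k
        ≡⟨ cong₂ _*_ ∑𝟙*1≡k ∑𝟙*1≡k ⟨
          ∑[ x < v ] (𝟙[ S ] x * 1ℤ) * ∑[ x < v ] (𝟙[ S ] x * 1ℤ)
        ≡⟨ character-sum-square (λ _ → 1ℤ) (λ _ _ → refl) refl ⟩
          + μ * ∑[ x < v ] 1ℤ + excess
        ≡⟨ cong (λ t → + μ * t + excess) (trans (∑-const v 1ℤ) (ℤP.*-identityʳ (+ v))) ⟩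
          + μ * + v + excess
        ∎
        where
          open ≡-Reasoning
          ∑𝟙*1≡k = trans (sum-cong-≗ (ℤP.*-identityʳ ∘ 𝟙[ S ])) ∑𝟙≡k

  module _ {H : Subset v} (H≤G : IsSubgroup G H) where
    private
      ∙-closed = proj₁ (proj₂ H≤G)
      ⁻¹-closed = proj₂ (proj₂ H≤G)

    ∙∈-cancelˡ : ∀ {x y} → x ∈ H → x ∙ y ∈ H → y ∈ H
    ∙∈-cancelˡ {x} {y} x∈H xy∈H = subst (_∈ H) (\\-leftDividesʳ x y) (∙-closed _ _ (⁻¹-closed x x∈H) xy∈H)

    ∙∈-cancelʳ : ∀ {x y} → y ∈ H → x ∙ y ∈ H → x ∈ H
    ∙∈-cancelʳ {x} {y} y∈H xy∈H = subst (_∈ H) (//-rightDividesʳ y x) (∙-closed _ _ xy∈H (⁻¹-closed y y∈H))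

  module Index2 {H : Subset v} (H≤G : IsSubgroup G H) (index : 2 ℕ.* ∣ H ∣ ≡ v) where
    private
      h = 𝟙[ H ]
      ε∈H = proj₁ H≤G
      ∙-closed = proj₁ (proj₂ H≤G)

    v≡∣H∣+∣H∣ : + v ≡ + ∣ H ∣ + + ∣ H ∣
    v≡∣H∣+∣H∣ = cong +_ (trans (sym index) (cong (ℕ._+_ ∣ H ∣) (ℕP.+-identityʳ ∣ H ∣)))

    -- As x ∉ H, at most one of z and x ∙ z lies in H; since H and x H both have v / 2
    -- elements, exactly one of them does.
    ∉⇒𝟙+𝟙∙≤1 : ∀ {x} → x ∉ H → ∀ z → h z + h (x ∙ z) ≤ 1ℤ
    ∉⇒𝟙+𝟙∙≤1 {x} x∉H z with z ∈? H | x ∙ z ∈? H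
    ... | yes z∈H | yes xz∈H = ⊥-elim (x∉H (∙∈-cancelʳ H≤G z∈H xz∈H))
    ... | yes _   | no _     = ℤP.≤-refl
    ... | no _    | yes _    = ℤP.≤-refl
    ... | no _    | no _     = +≤+ ℕ.z≤n

    ∑𝟙+𝟙∙≡∑1 : ∀ x → ∑[ z < v ] (h z + h (x ∙ z)) ≡ ∑[ z < v ] 1ℤ
    ∑𝟙+𝟙∙≡∑1 x = begin
        ∑[ z < v ] (h z + h (x ∙ z))
      ≡⟨ ∑-distrib-+ h (λ z → h (x ∙ z)) ⟩
        sum h + ∑[ z < v ] h (x ∙ z)
      ≡⟨ cong (_+_ (sum h)) (∑-translateˡ x h) ⟩
        sum h + sum h
      ≡⟨ cong₂ _+_ (∣p∣≡∑𝟙[p] H) (∣p∣≡∑𝟙[p] H) ⟨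
        + ∣ H ∣ + + ∣ H ∣
      ≡⟨ v≡∣H∣+∣H∣ ⟨
        + v
      ≡⟨ trans (∑-const v 1ℤ) (ℤP.*-identityʳ (+ v)) ⟨
        ∑[ z < v ] 1ℤ
      ∎
      where open ≡-Reasoning

    ∉∙∉⇒∈ : ∀ {x y} → x ∉ H → y ∉ H → x ∙ y ∈ H
    ∉∙∉⇒∈ {x} {y} x∉H y∉H with y ∈? H | x ∙ y ∈? H | ∑-≤-≡⇒≗ (∉⇒𝟙+𝟙∙≤1 x∉H) (∑𝟙+𝟙∙≡∑1 x) y
    ... | yes y∈H | _          | _ = ⊥-elim (y∉H y∈H)
    ... | no _    | yes xy∈H   | _ = xy∈H
    ... | no _    | no _       | ()

    χ : Fin v → ℤ
    χ x = h x + h x - 1ℤ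

    χ-∙ : ∀ x y → χ (x ∙ y) ≡ χ x * χ y
    χ-∙ x y with x ∈? H | y ∈? H | x ∙ y ∈? H
    ... | yes _   | yes _   | yes _    = refl
    ... | yes x∈H | yes y∈H | no xy∉H  = ⊥-elim (xy∉H (∙-closed x y x∈H y∈H))
    ... | yes x∈H | no y∉H  | yes xy∈H = ⊥-elim (y∉H (∙∈-cancelˡ H≤G x∈H xy∈H))
    ... | yes _   | no _    | no _     = refl
    ... | no x∉H  | yes y∈H | yes xy∈H = ⊥-elim (x∉H (∙∈-cancelʳ H≤G y∈H xy∈H))
    ... | no _    | yes _   | no _     = refl
    ... | no _    | no _    | yes _    = refl
    ... | no x∉H  | no y∉H  | no xy∉H  = ⊥-elim (xy∉H (∉∙∉⇒∈ x∉H y∉H))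

    χ-ε : χ ε ≡ 1ℤ
    χ-ε with ε ∈? H
    ... | yes _  = refl
    ... | no ε∉H = ⊥-elim (ε∉H ε∈H)

    ∑χ≡0 : sum χ ≡ 0ℤ
    ∑χ≡0 = begin
        ∑[ x < v ] (h x + h x + -1ℤ)
      ≡⟨ trans (∑-distrib-+ (λ x → h x + h x) (λ _ → -1ℤ)) (cong₂ _+_ (∑-distrib-+ h h) (∑-const v -1ℤ)) ⟩
        sum h + sum h + + v * -1ℤ
      ≡⟨ cong₂ (λ a b → a + a + b * -1ℤ) (sym (∣p∣≡∑𝟙[p] H)) v≡∣H∣+∣H∣ ⟩
        + ∣ H ∣ + + ∣ H ∣ + (+ ∣ H ∣ + + ∣ H ∣) * -1ℤ
      ≡⟨ cancel (+ ∣ H ∣) ⟩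
        0ℤ
      ∎
      where
        open ≡-Reasoning
        cancel : ∀ a → a + a + (a + a) * -1ℤ ≡ 0ℤ
        cancel = solve-∀

    odd⇒∑𝟙χ≢0 : ∀ (S : Subset v) → ∣ S ∣ % 2 ≡ 1 → ∑[ x < v ] (𝟙[ S ] x * χ x) ≢ 0ℤ
    odd⇒∑𝟙χ≢0 S ∣S∣-odd ∑𝟙χ≡0 = odd⇒≢double (∑[ x < v ] (s x * h x)) ∣S∣-odd (begin
        + ∣ S ∣
      ≡⟨ trans (∣p∣≡∑𝟙[p] S) (sym (ℤP.+-identityʳ (sum s))) ⟩
        sum s + 0ℤ
      ≡⟨ cong (_+_ (sum s)) ∑𝟙χ≡0 ⟨
        sum s + ∑[ x < v ] (s x * χ x)
      ≡⟨ ∑-distrib-+ s (λ x → s x * χ x) ⟨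
        ∑[ x < v ] (s x + s x * χ x)
      ≡⟨ sum-cong-≗ (λ x → expand (s x) (h x)) ⟩
        ∑[ x < v ] (s x * h x + s x * h x)
      ≡⟨ ∑-distrib-+ (λ x → s x * h x) (λ x → s x * h x) ⟩
        ∑[ x < v ] (s x * h x) + ∑[ x < v ] (s x * h x)
      ∎)
      where
        open ≡-Reasoning
        s = 𝟙[ S ]
        expand : ∀ a b → a + a * (b + b - 1ℤ) ≡ a * b + a * b
        expand = solve-∀

theorem3p5 : ∀ {v : ℕ} (G : FinGroup v) (S : Subset v) (k μ : ℕ) →
    IsSumSet G S k μ →
    HasNormalSubgroupOfIndex2 G →
    (∃ λ (m : ℤ) → (+ k * + k) - (+ μ * + v) ≡ m * m)
    × (k % 2 ≡ 1 → ¬ ((+ k * + k) - (+ μ * + v) ≡ + 0))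
theorem3p5 {v} G S k μ sumSet (H , H≤G , _ , index) = (T , n≡T*T) , n≢0
  where
    open Index2 G H≤G index using (χ; χ-∙; χ-ε; ∑χ≡0; odd⇒∑𝟙χ≢0)

    T : ℤ
    T = ∑[ x < v ] (𝟙[ S ] x * χ x)

    T*T≡excess : T * T ≡ excess G S sumSet
    T*T≡excess = trans (character-sum-square G S sumSet χ χ-∙ χ-ε)
                       (trans (cong (λ t → + μ * t + excess G S sumSet) ∑χ≡0) (drop (+ μ) (excess G S sumSet)))
      where drop : ∀ m e → m * 0ℤ + e ≡ e
            drop = solve-∀

    n≡T*T : + k * + k - + μ * + v ≡ T * T
    n≡T*T = trans (cong (_- + μ * + v) (k*k≡μ*v+excess G S sumSet))
                  (trans (cancel (+ μ * + v) (excess G S sumSet)) (sym T*T≡excess))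
      where cancel : ∀ a e → a + e - a ≡ e
            cancel = solve-∀

    n≢0 : k % 2 ≡ 1 → ¬ (+ k * + k - + μ * + v ≡ 0ℤ)
    n≢0 k-odd n≡0 = odd⇒∑𝟙χ≢0 S (subst (λ m → m % 2 ≡ 1) (sym (proj₁ sumSet)) k-odd)
                               ([ id , id ]′ (ℤP.i*j≡0⇒i≡0∨j≡0 T (trans (sym n≡T*T) n≡0)))
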